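{- For all $n\ge1$ and $0\le k\le n$, $$R_{k,2n+1}=(k+1)\binom{n}{k+1}^2(n!)^2+(2n+1-k)\binom{n}{k}^2(n!)^2=\frac{1}{k+1}\binom{n}{k}^2((n+1)!)^2.$$
   Context: $\mathcal{S}_m$ denotes the set of permutations $\sigma=\sigma_1\cdots\sigma_m$ of $\{1,\dots,m\}$. $\overleftarrow{des}_E(\sigma)$ is the number of indices $i\in\{1,\dots,m-1\}$ with $\sigma_i>\sigma_{i+1}$ and $\sigma_i$ even. $R_{k,m}$ denotes the number of $\sigma\in\mathcal{S}_m$ with $\overleftarrow{des}_E(\sigma)=k$. -}

module Defs where

open import Data.Nat using (ℕ; zero; suc; _+_; _*_; _<_; _<?_; _≟_)
open import Data.Nat.Divisibility using (_∣?_)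
open import Data.List using (List; []; _∷_; length; filter; map; concatMap; upTo)
open import Relation.Nullary using (yes; no)
import Data.List.Relation.Unary.Unique.DecPropositional as UniqueDec

words : ℕ → ℕ → List (List ℕ)
words m zero    = [] ∷ []
words m (suc ℓ) = concatMap (λ a → map (a ∷_) (words m ℓ)) (map suc (upTo m))

-- S_m : permutations σ = σ₁⋯σ_m of {1,…,m}, i.e. the words of length m
-- over {1,…,m} with pairwise distinct letters.
IsPerm : List ℕ → Set
IsPerm = UniqueDec.Unique _≟_

Sym : ℕ → List (List ℕ)
Sym m = filter (UniqueDec.unique? _≟_) (words m m)

evenDesc : ℕ → ℕ → ℕ
evenDesc a b with b <? a | 2 ∣? a
... | yes _ | yes _ = 1
... | _     | _     = 0

desE : List ℕ → ℕ
desE []            = 0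
desE (a ∷ [])      = 0
desE (a ∷ b ∷ w)   = evenDesc a b + desE (b ∷ w)

R : ℕ → ℕ → ℕ
R k m = length (filter (λ σ → desE σ ≟ k) (Sym m))

module Submission where

-- Every permutation of {1,…,m+1} arises exactly once by inserting the largest letter m+1 into a
-- permutation of {1,…,m}; so Sym m lists the same permutations as the iterated insertion Sym′ m,
-- each once. Being the largest letter, m+1 never ends a descent, and whether it starts an even one
-- depends only on its parity:
--  * an odd m+1 placed inside an even descent destroys it and changes nothing elsewhere, so a
--    permutation of length ℓ with d even descents yields ℓ+1−d permutations with d and d with d−1;
--  * an even m+1 placed at the end or inside an even descent keeps the count and adds one anywhere
--    else, so d+1 insertions keep d and ℓ−d give d+1.
-- Hence R(k,2n+1) = (2n+1−k) R(k,2n) + (k+1) R(k+1,2n) and R(k,2n+2) = (k+1) R(k,2n+1) + (2n+2−k) R(k−1,2n+1),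
-- and induction gives R(k,2n) = C(n,k)² (n!)². The closed forms satisfy these recurrences by the
-- absorption identity (k+1) C(n,k+1) = (n−k) C(n,k).

open import Defs
open import Data.Bool using (true; false; if_then_else_; T)
open import Data.Empty using (⊥-elim)
open import Data.List as List
  using (List; []; _∷_; [_]; _++_; length; filter; map; concatMap; upTo; cartesianProductWith)
open import Data.List.Properties
  using (∷-injective; ∷-injectiveʳ; upTo-∷ʳ; map-++; map-cong; length-map; length-upTo; filter-++; filter-reject; filter-all)
open import Data.List.Membership.Propositional using (_∈_; _∉_; find; lose)
open import Data.List.Membership.Propositional.Properties
  using (∈-∃++; ∈-concatMap⁺; ∈-concatMap⁻; ∈-cartesianProductWith⁺; ∈-cartesianProductWith⁻;
         ∈-filter⁺; ∈-filter⁻; ∈-map⁺; ∈-map⁻; ∈-upTo⁻)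
open import Data.List.Membership.Propositional.Properties.WithK using (unique∧set⇒bag)
open import Data.List.Relation.Binary.BagAndSetEquality using (∼bag⇒↭)
open import Data.List.Relation.Binary.Permutation.Propositional
  using (_↭_; ↭-refl; ↭-sym; ↭-trans; ↭-reflexive; ↭-prep; ↭⇒↭ₛ)
open import Data.List.Relation.Binary.Permutation.Propositional.Properties
  using (shift; drop-mid; filter-↭; ∈-resp-↭; ↭-length; ↭-empty-inv; ∷↭∷ʳ)
open import Data.List.Relation.Binary.Permutation.Setoid.Properties using (Unique-resp-↭)
open import Data.List.Relation.Unary.All as All using (All; []; _∷_)
open import Data.List.Relation.Unary.AllPairs using ([]; _∷_)
open import Data.List.Relation.Unary.Any using (here; there; any?)
open import Data.List.Relation.Unary.Unique.Propositional using (Unique)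
import Data.List.Relation.Unary.Unique.Propositional.Properties as Unique
import Data.List.Relation.Unary.Unique.DecPropositional as UniqueDec
open import Data.Nat using (ℕ; zero; suc; pred; _+_; _*_; _∸_; _^_; _!; _≤_; _<_; _≡ᵇ_; _≟_; _<?_; _≤?_; z≤n; s≤s)
open import Data.Nat.Combinatorics using (_C_; nCk+nC[k+1]≡[n+1]C[k+1]; nC1≡n; k>n⇒nCk≡0)
open import Data.Nat.Divisibility using (_∣_; _∣?_; divides)
open import Data.Nat.ListAction using (sum)
open import Data.Nat.ListAction.Properties using (sum-++)
open import Data.Nat.Properties
open import Algebra.Properties.CommutativeSemigroup +-commutativeSemigroup using (x∙yz≈y∙xz; interchange)
open import Algebra.Properties.CommutativeSemigroup *-commutativeSemigroup
  using () renaming (x∙yz≈y∙xz to x*[y*z]≡y*[x*z])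
open import Data.Nat.Tactic.RingSolver using (solve; solve-∀)
open import Data.Product using (∃; ∃₂; _×_; _,_; proj₁)
open import Data.Sum using (_⊎_; inj₁; inj₂)
open import Data.Unit using (tt)
open import Function using (_∘_)
open import Function.Bundles using (mk⇔)
open import Relation.Binary.Definitions using (DecidableEquality)
open import Relation.Binary.PropositionalEquality hiding ([_])
open import Relation.Nullary using (¬_; ¬?; Dec; yes; no)

evenDesc-≤ : ∀ {a b} → a ≤ b → evenDesc a b ≡ 0
evenDesc-≤ {a} {b} a≤b with b <? a
... | yes b<a = ⊥-elim (<⇒≱ b<a a≤b)
... | no _    = refl

evenDesc-even : ∀ {a b} → 2 ∣ a → b < a → evenDesc a b ≡ 1
evenDesc-even {a} {b} 2∣a b<a with b <? a | 2 ∣? a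
... | yes _  | yes _  = refl
... | yes _  | no 2∤a = ⊥-elim (2∤a 2∣a)
... | no b≮a | _      = ⊥-elim (b≮a b<a)

evenDesc-odd : ∀ {a} b → ¬ 2 ∣ a → evenDesc a b ≡ 0
evenDesc-odd {a} b 2∤a with b <? a | 2 ∣? a
... | yes _ | yes 2∣a = ⊥-elim (2∤a 2∣a)
... | yes _ | no _    = refl
... | no _  | _       = refl

evenDesc-0⊎1 : ∀ a b → evenDesc a b ≡ 0 ⊎ evenDesc a b ≡ 1
evenDesc-0⊎1 a b with b <? a | 2 ∣? a
... | yes _ | yes _ = inj₂ refl
... | yes _ | no _  = inj₁ refl
... | no _  | _     = inj₁ refl

evenDesc≤1 : ∀ a b → evenDesc a b ≤ 1
evenDesc≤1 a b with evenDesc-0⊎1 a b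
... | inj₁ e = ≤-trans (≤-reflexive e) z≤n
... | inj₂ e = ≤-reflexive e

desE[a∷w]≤length[w] : ∀ a w → desE (a ∷ w) ≤ length w
desE[a∷w]≤length[w] a []      = z≤n
desE[a∷w]≤length[w] a (b ∷ w) = +-mono-≤ (evenDesc≤1 a b) (desE[a∷w]≤length[w] b w)

desE-0∷ : ∀ w → desE (0 ∷ w) ≡ desE w
desE-0∷ []      = refl
desE-0∷ (b ∷ w) = cong (_+ desE (b ∷ w)) (evenDesc-≤ {b = b} z≤n)

desSum : (ℕ → ℕ) → List (List ℕ) → ℕ
desSum f = sum ∘ map (f ∘ desE)

desSum-++ : ∀ f L L′ → desSum f (L ++ L′) ≡ desSum f L + desSum f L′
desSum-++ f L L′ = trans (cong sum (map-++ (f ∘ desE) L L′)) (sum-++ (map (f ∘ desE) L) _)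

desSum-cong : ∀ {f g} → (∀ d → f d ≡ g d) → ∀ L → desSum f L ≡ desSum g L
desSum-cong f≗g L = cong sum (map-cong (f≗g ∘ desE) L)

desSum-+ : ∀ f g L → desSum (λ d → f d + g d) L ≡ desSum f L + desSum g L
desSum-+ f g []      = refl
desSum-+ f g (σ ∷ L) = trans (cong (f (desE σ) + g (desE σ) +_) (desSum-+ f g L))
                             (interchange (f (desE σ)) (g (desE σ)) _ _)

desSum-shift : ∀ f a b X →
  desSum f (map (a ∷_) (map (b ∷_) X)) ≡ desSum (f ∘ (evenDesc a b +_)) (map (b ∷_) X)
desSum-shift f a b []      = refl
desSum-shift f a b (w ∷ X) = cong (f (evenDesc a b + desE (b ∷ w)) +_) (desSum-shift f a b X)

desSum-0∷ : ∀ f L → desSum f (map (0 ∷_) L) ≡ desSum f L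
desSum-0∷ f []      = refl
desSum-0∷ f (w ∷ L) = cong₂ _+_ (cong f (desE-0∷ w)) (desSum-0∷ f L)

𝟙[_≡_] : ℕ → ℕ → ℕ
𝟙[ d ≡ k ] = if d ≡ᵇ k then 1 else 0

count : ℕ → List (List ℕ) → ℕ
count k = desSum 𝟙[_≡ k ]

*-𝟙 : ∀ (g : ℕ → ℕ) d k → g d * 𝟙[ d ≡ k ] ≡ g k * 𝟙[ d ≡ k ]
*-𝟙 g d k with d ≡ᵇ k in d≡ᵇk
... | true  rewrite ≡ᵇ⇒≡ d k (subst T (sym d≡ᵇk) tt) = refl
... | false = trans (*-zeroʳ (g d)) (sym (*-zeroʳ (g k)))

*-𝟙-pred : ∀ d k → d * 𝟙[ pred d ≡ k ] ≡ d * 𝟙[ d ≡ suc k ]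
*-𝟙-pred zero    k = refl
*-𝟙-pred (suc d) k = refl

desSum-weighted : ∀ (g : ℕ → ℕ) k L → desSum (λ d → g d * 𝟙[ d ≡ k ]) L ≡ g k * count k L
desSum-weighted g k []      = sym (*-zeroʳ (g k))
desSum-weighted g k (σ ∷ L) = begin
  g (desE σ) * 𝟙[ desE σ ≡ k ] + desSum (λ d → g d * 𝟙[ d ≡ k ]) L
    ≡⟨ cong₂ _+_ (*-𝟙 g (desE σ) k) (desSum-weighted g k L) ⟩
  g k * 𝟙[ desE σ ≡ k ] + g k * count k L
    ≡⟨ *-distribˡ-+ (g k) _ _ ⟨
  g k * count k (σ ∷ L) ∎
  where open ≡-Reasoning

desSum-weighted₂ : ∀ (g h : ℕ → ℕ) k l L →
  desSum (λ d → g d * 𝟙[ d ≡ k ] + h d * 𝟙[ d ≡ l ]) L ≡ g k * count k L + h l * count l L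
desSum-weighted₂ g h k l L = trans (desSum-+ (λ d → g d * 𝟙[ d ≡ k ]) (λ d → h d * 𝟙[ d ≡ l ]) L)
                                   (cong₂ _+_ (desSum-weighted g k L) (desSum-weighted h l L))

length-filter≡count : ∀ k L → length (filter (λ σ → desE σ ≟ k) L) ≡ count k L
length-filter≡count k []      = refl
length-filter≡count k (σ ∷ L) with desE σ ≡ᵇ k
... | true  = cong suc (length-filter≡count k L)
... | false = length-filter≡count k L

-- Inserting a largest letter

ins : ℕ → List ℕ → List (List ℕ)
ins x []      = [ x ∷ [] ]
ins x (a ∷ w) = (x ∷ a ∷ w) ∷ map (a ∷_) (ins x w)

*-suc-pred : ∀ d (f : ℕ → ℕ) → d * f (suc (pred d)) ≡ d * f d
*-suc-pred zero    f = refl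
*-suc-pred (suc d) f = refl

-- Stated for every f so that the induction can absorb the even descent at a, b into a shift of f.
desSum-ins-after-odd : ∀ {x} → ¬ 2 ∣ x → ∀ {a w} → a < x → All (_< x) w → ∀ f →
  let D = desE (a ∷ w) in
  desSum f (map (a ∷_) (ins x w)) ≡ (suc (length w) ∸ D) * f D + D * f (pred D)
desSum-ins-after-odd 2∤x {a} {[]} a<x [] f
  rewrite evenDesc-≤ (<⇒≤ a<x) = sym (+-identityʳ (f 0 + 0))
desSum-ins-after-odd {x} 2∤x {a} {b ∷ w} a<x (b<x ∷ w<x) f
  rewrite evenDesc-≤ (<⇒≤ a<x) | evenDesc-odd b 2∤x
        | desSum-shift f a b (ins x w)
        | desSum-ins-after-odd 2∤x b<x w<x (f ∘ (evenDesc a b +_))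
  with evenDesc a b | evenDesc-0⊎1 a b
... | _ | inj₁ refl rewrite +-∸-assoc 1 (≤-trans (desE[a∷w]≤length[w] b w) (n≤1+n _)) =
  sym (+-assoc (f D) _ _)
  where
  D : ℕ
  D = desE (b ∷ w)
... | _ | inj₂ refl rewrite *-suc-pred (desE (b ∷ w)) f =
  x∙yz≈y∙xz (f D) ((suc (length w) ∸ D) * f (suc D)) (D * f D)
  where
  D : ℕ
  D = desE (b ∷ w)

desSum-ins-after-even : ∀ {x} → 2 ∣ x → ∀ {a w} → a < x → All (_< x) w → ∀ f →
  let D = desE (a ∷ w) in
  desSum f (map (a ∷_) (ins x w)) ≡ suc D * f D + (length w ∸ D) * f (suc D)
desSum-ins-after-even 2∣x {a} {[]} a<x [] f
  rewrite evenDesc-≤ (<⇒≤ a<x) = sym (+-identityʳ (f 0 + 0))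
desSum-ins-after-even {x} 2∣x {a} {b ∷ w} a<x (b<x ∷ w<x) f
  rewrite evenDesc-≤ (<⇒≤ a<x) | evenDesc-even 2∣x b<x
        | desSum-shift f a b (ins x w)
        | desSum-ins-after-even 2∣x b<x w<x (f ∘ (evenDesc a b +_))
  with evenDesc a b | evenDesc-0⊎1 a b
... | _ | inj₁ refl rewrite +-∸-assoc 1 (desE[a∷w]≤length[w] b w) =
  x∙yz≈y∙xz (f (suc D)) (suc D * f D) ((length w ∸ D) * f (suc D))
  where
  D : ℕ
  D = desE (b ∷ w)
... | _ | inj₂ refl = sym (+-assoc (f (suc D)) _ _)
  where
  D : ℕ
  D = desE (b ∷ w)

oddInsertionSum : ℕ → (ℕ → ℕ) → ℕ → ℕ
oddInsertionSum ℓ f d = (suc ℓ ∸ d) * f d + d * f (pred d)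

evenInsertionSum : ℕ → (ℕ → ℕ) → ℕ → ℕ
evenInsertionSum ℓ f d = suc d * f d + (ℓ ∸ d) * f (suc d)

-- A leading 0 creates no even descent, so inserting into σ is inserting after the first letter of 0 ∷ σ.
desSum-ins-odd : ∀ {x} → ¬ 2 ∣ x → 0 < x → ∀ {σ} → All (_< x) σ → ∀ f →
  desSum f (ins x σ) ≡ oddInsertionSum (length σ) f (desE σ)
desSum-ins-odd 2∤x 0<x {σ} σ<x f with desSum-ins-after-odd 2∤x 0<x σ<x f
... | eq rewrite desE-0∷ σ = trans (sym (desSum-0∷ f (ins _ σ))) eq

desSum-ins-even : ∀ {x} → 2 ∣ x → 0 < x → ∀ {σ} → All (_< x) σ → ∀ f →
  desSum f (ins x σ) ≡ evenInsertionSum (length σ) f (desE σ)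
desSum-ins-even 2∣x 0<x {σ} σ<x f with desSum-ins-after-even 2∣x 0<x σ<x f
... | eq rewrite desE-0∷ σ = trans (sym (desSum-0∷ f (ins _ σ))) eq

desSum-concatMap-ins : ∀ {x m} (weight : ℕ → (ℕ → ℕ) → ℕ → ℕ) →
  (∀ {σ} → All (_< x) σ → ∀ f → desSum f (ins x σ) ≡ weight (length σ) f (desE σ)) →
  ∀ {L} → All (λ τ → length τ ≡ m × All (_< x) τ) L →
  ∀ f → desSum f (concatMap (ins x) L) ≡ desSum (weight m f) L
desSum-concatMap-ins weight desSum-ins [] f = refl
desSum-concatMap-ins {x} weight desSum-ins {τ ∷ L} ((refl , τ<x) ∷ L-bounded) f =
  trans (desSum-++ f (ins x τ) (concatMap (ins x) L))
        (cong₂ _+_ (desSum-ins τ<x f) (desSum-concatMap-ins weight desSum-ins L-bounded f))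

-- Permutations as rearrangements of the alphabet

∈⇒↭∷ : ∀ {A : Set} {y : A} {ys} → y ∈ ys → ∃ λ zs → ys ↭ y ∷ zs
∈⇒↭∷ {y = y} y∈ys with ∈-∃++ y∈ys
... | P , Q , refl = P ++ Q , shift y P Q

∈-∷-≢ : ∀ {A : Set} {z y : A} {zs} → z ∈ y ∷ zs → z ≢ y → z ∈ zs
∈-∷-≢ (here z≡y)   z≢y = ⊥-elim (z≢y z≡y)
∈-∷-≢ (there z∈zs) _   = z∈zs

length-≤-Unique-⊆ : ∀ {A : Set} {xs ys : List A} → Unique xs → All (_∈ ys) xs → length xs ≤ length ys
length-≤-Unique-⊆ []           []             = z≤n
length-≤-Unique-⊆ {xs = _ ∷ xs} (x∉xs ∷ uxs) (x∈ys ∷ xs⊆ys) with ∈⇒↭∷ x∈ys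
... | zs , ys↭x∷zs = subst (_ ≤_) (sym (↭-length ys↭x∷zs)) (s≤s (length-≤-Unique-⊆ uxs xs⊆zs))
  where
  xs⊆zs : All (_∈ zs) xs
  xs⊆zs = All.zipWith (λ (x≢z , z∈ys) → ∈-∷-≢ (∈-resp-↭ ys↭x∷zs z∈ys) (x≢z ∘ sym)) (x∉xs , xs⊆ys)

Unique-⊆-length⇒↭ : ∀ {A : Set} → DecidableEquality A → ∀ {xs ys : List A} →
  Unique xs → Unique ys → All (_∈ ys) xs → length ys ≤ length xs → xs ↭ ys
Unique-⊆-length⇒↭ _≟ᴬ_ {xs} {ys} uxs uys xs⊆ys |ys|≤|xs| =
  ∼bag⇒↭ (unique∧set⇒bag uxs uys (mk⇔ (All.lookup xs⊆ys) ys⊆xs))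
  where
  ys⊆xs : ∀ {y} → y ∈ ys → y ∈ xs
  ys⊆xs {y} y∈ys with any? (y ≟ᴬ_) xs
  ... | yes y∈xs = y∈xs
  ... | no  y∉xs with ∈⇒↭∷ y∈ys
  ...   | zs , ys↭y∷zs = ⊥-elim (<⇒≱ (subst (_≤ length xs) (↭-length ys↭y∷zs) |ys|≤|xs|)
                                        (length-≤-Unique-⊆ uxs xs⊆zs))
    where
    xs⊆zs : All (_∈ zs) xs
    xs⊆zs = All.tabulate λ x∈xs →
      ∈-∷-≢ (∈-resp-↭ ys↭y∷zs (All.lookup xs⊆ys x∈xs)) (λ x≡y → y∉xs (subst (_∈ xs) x≡y x∈xs))

alphabet : ℕ → List ℕ
alphabet m = map suc (upTo m)

alphabet-suc : ∀ m → alphabet (suc m) ↭ suc m ∷ alphabet m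
alphabet-suc m = ↭-trans (↭-reflexive alphabet[1+m]≡alphabet[m]∷ʳ1+m) (↭-sym (∷↭∷ʳ (suc m) (alphabet m)))
  where
  alphabet[1+m]≡alphabet[m]∷ʳ1+m : alphabet (suc m) ≡ alphabet m ++ [ suc m ]
  alphabet[1+m]≡alphabet[m]∷ʳ1+m = trans (cong (map suc) (sym (upTo-∷ʳ m))) (map-++ suc (upTo m) [ m ])

length-alphabet : ∀ m → length (alphabet m) ≡ m
length-alphabet m = trans (length-map suc (upTo m)) (length-upTo m)

Unique-alphabet : ∀ m → Unique (alphabet m)
Unique-alphabet m = Unique.map⁺ suc-injective (Unique.upTo⁺ m)

alphabet-bounded : ∀ m → All (_< suc m) (alphabet m)
alphabet-bounded m = All.tabulate λ a∈ → bounded (∈-map⁻ suc a∈)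
  where
  bounded : ∀ {a} → ∃ (λ i → i ∈ upTo m × a ≡ suc i) → a < suc m
  bounded (i , i∈ , refl) = s≤s (∈-upTo⁻ i∈)

concatMap-map≡cartesianProductWith : ∀ {A B C : Set} (f : A → B → C) xs ys →
  concatMap (λ x → map (f x) ys) xs ≡ cartesianProductWith f xs ys
concatMap-map≡cartesianProductWith f []       ys = refl
concatMap-map≡cartesianProductWith f (x ∷ xs) ys =
  cong (map (f x) ys ++_) (concatMap-map≡cartesianProductWith f xs ys)

words-suc : ∀ m ℓ → words m (suc ℓ) ≡ cartesianProductWith _∷_ (alphabet m) (words m ℓ)
words-suc m ℓ = concatMap-map≡cartesianProductWith _∷_ (alphabet m) (words m ℓ)

∈-words⁻ : ∀ m ℓ {σ} → σ ∈ words m ℓ → length σ ≡ ℓ × All (_∈ alphabet m) σ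
∈-words⁻ m zero    (here refl) = refl , []
∈-words⁻ m (suc ℓ) σ∈words
  with ∈-cartesianProductWith⁻ _∷_ (alphabet m) (words m ℓ) (subst (_ ∈_) (words-suc m ℓ) σ∈words)
... | a , τ , a∈ , τ∈ , refl with ∈-words⁻ m ℓ τ∈
...   | len , τ⊆ = cong suc len , a∈ ∷ τ⊆

∈-words⁺ : ∀ m {σ} → All (_∈ alphabet m) σ → σ ∈ words m (length σ)
∈-words⁺ m []            = here refl
∈-words⁺ m {a ∷ σ} (a∈ ∷ σ⊆) =
  subst (a ∷ σ ∈_) (sym (words-suc m (length σ))) (∈-cartesianProductWith⁺ _∷_ a∈ (∈-words⁺ m σ⊆))

Unique-words : ∀ m ℓ → Unique (words m ℓ)
Unique-words m zero    = [] ∷ []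
Unique-words m (suc ℓ) = subst Unique (sym (words-suc m ℓ))
  (Unique.cartesianProductWith⁺ _∷_ ∷-injective (Unique-alphabet m) (Unique-words m ℓ))

∈-Sym⁻ : ∀ m {σ} → σ ∈ Sym m → σ ↭ alphabet m
∈-Sym⁻ m σ∈ with ∈-filter⁻ (UniqueDec.unique? _≟_) {xs = words m m} σ∈
... | σ∈words , uσ with ∈-words⁻ m m σ∈words
...   | len , σ⊆ = Unique-⊆-length⇒↭ _≟_ uσ (Unique-alphabet m) σ⊆
                     (≤-reflexive (trans (length-alphabet m) (sym len)))

∈-Sym⁺ : ∀ m {σ} → σ ↭ alphabet m → σ ∈ Sym m
∈-Sym⁺ m {σ} σ↭ = ∈-filter⁺ (UniqueDec.unique? _≟_) σ∈words uσ
  where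
  σ∈words : σ ∈ words m m
  σ∈words = subst (λ ℓ → σ ∈ words m ℓ) (trans (↭-length σ↭) (length-alphabet m))
                  (∈-words⁺ m (All.tabulate (∈-resp-↭ σ↭)))
  uσ : Unique σ
  uσ = Unique-resp-↭ (setoid ℕ) (↭⇒↭ₛ (↭-sym σ↭)) (Unique-alphabet m)

Unique-Sym : ∀ m → Unique (Sym m)
Unique-Sym m = Unique.filter⁺ (UniqueDec.unique? _≟_) (Unique-words m m)

∈-ins⁺ : ∀ x P Q → P ++ x ∷ Q ∈ ins x (P ++ Q)
∈-ins⁺ x []      []      = here refl
∈-ins⁺ x []      (b ∷ Q) = here refl
∈-ins⁺ x (a ∷ P) Q       = there (∈-map⁺ (a ∷_) (∈-ins⁺ x P Q))

∈-ins⁻ : ∀ x τ {σ} → σ ∈ ins x τ → ∃₂ λ P Q → τ ≡ P ++ Q × σ ≡ P ++ x ∷ Q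
∈-ins⁻ x []      (here refl) = [] , [] , refl , refl
∈-ins⁻ x (a ∷ w) (here refl) = [] , a ∷ w , refl , refl
∈-ins⁻ x (a ∷ w) (there σ∈) with ∈-map⁻ (a ∷_) σ∈
... | v , v∈ , refl with ∈-ins⁻ x w v∈
...   | P , Q , refl , refl = a ∷ P , Q , refl , refl

erase : ℕ → List ℕ → List ℕ
erase x = filter (λ y → ¬? (y ≟ x))

erase-ins : ∀ {x τ σ} → x ∉ τ → σ ∈ ins x τ → erase x σ ≡ τ
erase-ins {x} {τ} x∉τ σ∈ with ∈-ins⁻ x τ σ∈
... | P , Q , refl , refl = begin
  erase x (P ++ x ∷ Q)      ≡⟨ filter-++ ¬x? P (x ∷ Q) ⟩
  erase x P ++ erase x (x ∷ Q) ≡⟨ cong (erase x P ++_) (filter-reject ¬x? (λ x≢x → x≢x refl)) ⟩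
  erase x P ++ erase x Q    ≡⟨ filter-++ ¬x? P Q ⟨
  erase x (P ++ Q)          ≡⟨ filter-all ¬x? (All.tabulate λ y∈ y≡x → x∉τ (subst (_∈ P ++ Q) y≡x y∈)) ⟩
  P ++ Q                    ∎
  where
  open ≡-Reasoning
  ¬x? : ∀ y → Dec (¬ y ≡ x)
  ¬x? y = ¬? (y ≟ x)

Unique-ins : ∀ {x τ} → x ∉ τ → Unique (ins x τ)
Unique-ins {x} {[]}    _   = [] ∷ []
Unique-ins {x} {a ∷ w} x∉ = All.tabulate head≢ ∷ Unique.map⁺ ∷-injectiveʳ (Unique-ins (x∉ ∘ there))
  where
  head≢ : ∀ {v} → v ∈ map (a ∷_) (ins x w) → x ∷ a ∷ w ≢ v
  head≢ v∈ eq with ∈-map⁻ (a ∷_) v∈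
  ... | u , _ , refl = x∉ (here (proj₁ (∷-injective eq)))

Unique-concatMap-ins : ∀ {x L} → Unique L → All (x ∉_) L → Unique (concatMap (ins x) L)
Unique-concatMap-ins {L = []}    []           []           = []
Unique-concatMap-ins {x} {τ ∷ L} (τ∉L ∷ uL) (x∉τ ∷ x∉L) =
  Unique.++⁺ (Unique-ins x∉τ) (Unique-concatMap-ins uL x∉L) disjoint
  where
  disjoint : ∀ {σ} → ¬ (σ ∈ ins x τ × σ ∈ concatMap (ins x) L)
  disjoint (σ∈ , σ∈′) with find (∈-concatMap⁻ (ins x) {xs = L} σ∈′)
  ... | τ′ , τ′∈L , σ∈ins′ =
    All.lookup τ∉L τ′∈L (trans (sym (erase-ins x∉τ σ∈)) (erase-ins (All.lookup x∉L τ′∈L) σ∈ins′))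

Sym′ : ℕ → List (List ℕ)
Sym′ zero    = [ [] ]
Sym′ (suc m) = concatMap (ins (suc m)) (Sym′ m)

∈-Sym′⁻ : ∀ m {σ} → σ ∈ Sym′ m → σ ↭ alphabet m
∈-Sym′⁻ zero    (here refl) = ↭-refl
∈-Sym′⁻ (suc m) σ∈ with find (∈-concatMap⁻ (ins (suc m)) {xs = Sym′ m} σ∈)
... | τ , τ∈ , σ∈ins with ∈-ins⁻ (suc m) τ σ∈ins
...   | P , Q , refl , refl =
  ↭-trans (shift (suc m) P Q) (↭-trans (↭-prep (suc m) (∈-Sym′⁻ m τ∈)) (↭-sym (alphabet-suc m)))

∈-Sym′⁺ : ∀ m {σ} → σ ↭ alphabet m → σ ∈ Sym′ m
∈-Sym′⁺ zero    σ↭ rewrite ↭-empty-inv σ↭ = here refl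
∈-Sym′⁺ (suc m) σ↭ with ∈-∃++ (∈-resp-↭ (↭-sym (↭-trans σ↭ (alphabet-suc m))) (here refl))
... | P , Q , refl = ∈-concatMap⁺ (ins (suc m)) {xs = Sym′ m}
  (lose (∈-Sym′⁺ m (drop-mid P [] (↭-trans σ↭ (alphabet-suc m)))) (∈-ins⁺ (suc m) P Q))

Sym′-bounded : ∀ m → All (λ τ → length τ ≡ m × All (_< suc m) τ) (Sym′ m)
Sym′-bounded m = All.tabulate λ τ∈ → let τ↭ = ∈-Sym′⁻ m τ∈ in
  trans (↭-length τ↭) (length-alphabet m) ,
  All.tabulate (λ a∈ → All.lookup (alphabet-bounded m) (∈-resp-↭ τ↭ a∈))

Unique-Sym′ : ∀ m → Unique (Sym′ m)
Unique-Sym′ zero    = [] ∷ []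
Unique-Sym′ (suc m) = Unique-concatMap-ins (Unique-Sym′ m)
  (All.map (λ (_ , τ<) 1+m∈τ → <-irrefl refl (All.lookup τ< 1+m∈τ)) (Sym′-bounded m))

Sym↭Sym′ : ∀ m → Sym m ↭ Sym′ m
Sym↭Sym′ m = ∼bag⇒↭ (unique∧set⇒bag (Unique-Sym m) (Unique-Sym′ m)
  (mk⇔ (∈-Sym′⁺ m ∘ ∈-Sym⁻ m) (∈-Sym⁺ m ∘ ∈-Sym′⁻ m)))

R≡count-Sym′ : ∀ k m → R k m ≡ count k (Sym′ m)
R≡count-Sym′ k m = trans (↭-length (filter-↭ (λ σ → desE σ ≟ k) (Sym↭Sym′ m)))
                         (length-filter≡count k (Sym′ m))

count-Sym′-odd : ∀ m → ¬ 2 ∣ suc m → ∀ k →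
  count k (Sym′ (suc m)) ≡ (suc m ∸ k) * count k (Sym′ m) + suc k * count (suc k) (Sym′ m)
count-Sym′-odd m 2∤1+m k = begin
  count k (Sym′ (suc m))
    ≡⟨ desSum-concatMap-ins oddInsertionSum (desSum-ins-odd 2∤1+m (s≤s z≤n)) (Sym′-bounded m) 𝟙[_≡ k ] ⟩
  desSum (oddInsertionSum m 𝟙[_≡ k ]) (Sym′ m)
    ≡⟨ desSum-cong (λ d → cong ((suc m ∸ d) * 𝟙[ d ≡ k ] +_) (*-𝟙-pred d k)) (Sym′ m) ⟩
  desSum (λ d → (suc m ∸ d) * 𝟙[ d ≡ k ] + d * 𝟙[ d ≡ suc k ]) (Sym′ m)
    ≡⟨ desSum-weighted₂ (suc m ∸_) (λ d → d) k (suc k) (Sym′ m) ⟩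
  (suc m ∸ k) * count k (Sym′ m) + suc k * count (suc k) (Sym′ m) ∎
  where open ≡-Reasoning

count-Sym′-even-zero : ∀ m → 2 ∣ suc m → count 0 (Sym′ (suc m)) ≡ count 0 (Sym′ m)
count-Sym′-even-zero m 2∣1+m = begin
  count 0 (Sym′ (suc m))
    ≡⟨ desSum-concatMap-ins evenInsertionSum (desSum-ins-even 2∣1+m (s≤s z≤n)) (Sym′-bounded m) 𝟙[_≡ 0 ] ⟩
  desSum (evenInsertionSum m 𝟙[_≡ 0 ]) (Sym′ m)
    ≡⟨ desSum-cong (λ d → trans (cong (suc d * 𝟙[ d ≡ 0 ] +_) (*-zeroʳ (m ∸ d))) (+-identityʳ _)) (Sym′ m) ⟩
  desSum (λ d → suc d * 𝟙[ d ≡ 0 ]) (Sym′ m)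
    ≡⟨ desSum-weighted suc 0 (Sym′ m) ⟩
  1 * count 0 (Sym′ m)
    ≡⟨ *-identityˡ _ ⟩
  count 0 (Sym′ m) ∎
  where open ≡-Reasoning

count-Sym′-even-suc : ∀ m → 2 ∣ suc m → ∀ j →
  count (suc j) (Sym′ (suc m)) ≡ suc (suc j) * count (suc j) (Sym′ m) + (m ∸ j) * count j (Sym′ m)
count-Sym′-even-suc m 2∣1+m j =
  trans (desSum-concatMap-ins evenInsertionSum (desSum-ins-even 2∣1+m (s≤s z≤n)) (Sym′-bounded m) 𝟙[_≡ suc j ])
        (desSum-weighted₂ suc (m ∸_) (suc j) j (Sym′ m))

-- Binomial identities

[k+1]*[n+1]C[k+1]≡[n+1]*nCk : ∀ n k → suc k * (suc n C suc k) ≡ suc n * (n C k)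
[k+1]*[n+1]C[k+1]≡[n+1]*nCk zero    zero    = refl
[k+1]*[n+1]C[k+1]≡[n+1]*nCk zero    (suc k) = *-zeroʳ (suc (suc k))
[k+1]*[n+1]C[k+1]≡[n+1]*nCk (suc n) zero    =
  trans (+-identityʳ _) (trans (nC1≡n (suc (suc n))) (sym (*-identityʳ _)))
[k+1]*[n+1]C[k+1]≡[n+1]*nCk (suc n) (suc k) = begin
  suc (suc k) * (suc (suc n) C suc (suc k))
    ≡⟨ cong (suc (suc k) *_) (nCk+nC[k+1]≡[n+1]C[k+1] (suc n) (suc k)) ⟨
  suc (suc k) * (suc n C suc k + suc n C suc (suc k))
    ≡⟨ *-distribˡ-+ (suc (suc k)) (suc n C suc k) _ ⟩
  suc n C suc k + suc k * (suc n C suc k) + suc (suc k) * (suc n C suc (suc k))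
    ≡⟨ cong₂ (λ u v → suc n C suc k + u + v) ([k+1]*[n+1]C[k+1]≡[n+1]*nCk n k)
                                               ([k+1]*[n+1]C[k+1]≡[n+1]*nCk n (suc k)) ⟩
  suc n C suc k + suc n * (n C k) + suc n * (n C suc k)
    ≡⟨ +-assoc (suc n C suc k) _ _ ⟩
  suc n C suc k + (suc n * (n C k) + suc n * (n C suc k))
    ≡⟨ cong (suc n C suc k +_) (*-distribˡ-+ (suc n) (n C k) _) ⟨
  suc n C suc k + suc n * (n C k + n C suc k)
    ≡⟨ cong (λ c → suc n C suc k + suc n * c) (nCk+nC[k+1]≡[n+1]C[k+1] n k) ⟩
  suc (suc n) * (suc n C suc k) ∎
  where open ≡-Reasoning

[k+1]*[k+d]C[k+1]≡d*[k+d]Ck : ∀ k d → suc k * ((k + d) C suc k) ≡ d * ((k + d) C k)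
[k+1]*[k+d]C[k+1]≡d*[k+d]Ck k d = +-cancelˡ-≡ (suc k * a) _ _ (begin
  suc k * a + suc k * b     ≡⟨ *-distribˡ-+ (suc k) a b ⟨
  suc k * (a + b)           ≡⟨ cong (suc k *_) (nCk+nC[k+1]≡[n+1]C[k+1] (k + d) k) ⟩
  suc k * (suc (k + d) C suc k) ≡⟨ [k+1]*[n+1]C[k+1]≡[n+1]*nCk (k + d) k ⟩
  suc (k + d) * a           ≡⟨ *-distribʳ-+ a (suc k) d ⟩
  suc k * a + d * a         ∎)
  where
  open ≡-Reasoning
  a b : ℕ
  a = (k + d) C k
  b = (k + d) C suc k

x²≡x*x : ∀ x → x ^ 2 ≡ x * x
x²≡x*x x = cong (x *_) (*-identityʳ x)

-- The solver's variable lists use List.[] and List._∷_: unqualified, these constructors are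
-- ambiguous with those of All and AllPairs, which makes elaboration blow up.
squares-from-absorption-odd : ∀ k d a b → suc k * b ≡ d * a →
  suc k * (suc k * b ^ 2 + suc (k + 2 * d) * a ^ 2) ≡ suc (k + d) ^ 2 * a ^ 2
squares-from-absorption-odd k d a b [k+1]b≡da rewrite x²≡x*x a | x²≡x*x b = begin
  suc k * (suc k * (b * b) + suc (k + 2 * d) * (a * a))          ≡⟨ solve (k List.∷ d List.∷ a List.∷ b List.∷ List.[]) ⟩
  (suc k * b) * (suc k * b) + suc k * suc (k + 2 * d) * (a * a)  ≡⟨ cong (λ c → c * c + suc k * suc (k + 2 * d) * (a * a)) [k+1]b≡da ⟩
  (d * a) * (d * a) + suc k * suc (k + 2 * d) * (a * a)          ≡⟨ solve (k List.∷ d List.∷ a List.∷ List.[]) ⟩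
  suc (k + d) * suc (k + d) * (a * a)                            ≡⟨ cong (_* (a * a)) (x²≡x*x (suc (k + d))) ⟨
  suc (k + d) ^ 2 * (a * a)                                      ∎
  where open ≡-Reasoning

squares-from-absorption-even : ∀ j d a b → suc j * b ≡ d * a →
  suc (j + 2 * d) * a ^ 2 + suc j * b ^ 2 ≡ suc j * (a + b) ^ 2
squares-from-absorption-even j d a b [j+1]b≡da rewrite x²≡x*x a | x²≡x*x b = begin
  suc (j + 2 * d) * (a * a) + suc j * (b * b)             ≡⟨ solve (j List.∷ d List.∷ a List.∷ b List.∷ List.[]) ⟩
  suc j * (a * a) + 2 * a * (d * a) + b * (suc j * b)     ≡⟨ cong (λ c → suc j * (a * a) + 2 * a * c + b * (suc j * b)) [j+1]b≡da ⟨
  suc j * (a * a) + 2 * a * (suc j * b) + b * (suc j * b) ≡⟨ solve (j List.∷ a List.∷ b List.∷ List.[]) ⟩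
  suc j * ((a + b) * (a + b))                             ≡⟨ cong (suc j *_) (x²≡x*x (a + b)) ⟨
  suc j * (a + b) ^ 2                                     ∎
  where open ≡-Reasoning

2[k+d]+1∸k≡k+2d+1 : ∀ k d → suc (2 * (k + d)) ∸ k ≡ suc (k + 2 * d)
2[k+d]+1∸k≡k+2d+1 k d = begin
  suc (2 * (k + d)) ∸ k      ≡⟨ cong (_∸ k) (solve (k List.∷ d List.∷ List.[])) ⟩
  k + suc (k + 2 * d) ∸ k    ≡⟨ m+n∸m≡n k (suc (k + 2 * d)) ⟩
  suc (k + 2 * d)            ∎
  where open ≡-Reasoning

≤⊎nCk≡nC[k+1]≡0 : ∀ n k → (∃ λ d → n ≡ k + d) ⊎ (n C k ≡ 0 × n C suc k ≡ 0)
≤⊎nCk≡nC[k+1]≡0 n k with k ≤? n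
... | yes k≤n = inj₁ (n ∸ k , sym (m+[n∸m]≡n k≤n))
... | no  k≰n = inj₂ (k>n⇒nCk≡0 (≰⇒> k≰n) , k>n⇒nCk≡0 (m<n⇒m<1+n (≰⇒> k≰n)))

[k+1]*[[k+1]*nC[k+1]²+[2n+1-k]*nCk²]≡[n+1]²*nCk² : ∀ n k →
  suc k * (suc k * (n C suc k) ^ 2 + (suc (2 * n) ∸ k) * (n C k) ^ 2) ≡ suc n ^ 2 * (n C k) ^ 2
[k+1]*[[k+1]*nC[k+1]²+[2n+1-k]*nCk²]≡[n+1]²*nCk² n k with ≤⊎nCk≡nC[k+1]≡0 n k
... | inj₁ (d , refl) rewrite 2[k+d]+1∸k≡k+2d+1 k d =
  squares-from-absorption-odd k d _ _ ([k+1]*[k+d]C[k+1]≡d*[k+d]Ck k d)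
... | inj₂ (nCk≡0 , nC[k+1]≡0) rewrite nCk≡0 | nC[k+1]≡0 = vanish (suc k) (suc (2 * n) ∸ k) (suc n ^ 2)
  where
  vanish : ∀ s x y → s * (s * 0 + x * 0) ≡ y * 0
  vanish = solve-∀

[2n+1-j]*nCj²+[j+1]*nC[j+1]²≡[j+1]*[n+1]C[j+1]² : ∀ n j →
  (suc (2 * n) ∸ j) * (n C j) ^ 2 + suc j * (n C suc j) ^ 2 ≡ suc j * (suc n C suc j) ^ 2
[2n+1-j]*nCj²+[j+1]*nC[j+1]²≡[j+1]*[n+1]C[j+1]² n j
  rewrite sym (nCk+nC[k+1]≡[n+1]C[k+1] n j) with ≤⊎nCk≡nC[k+1]≡0 n j
... | inj₁ (d , refl) rewrite 2[k+d]+1∸k≡k+2d+1 j d =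
  squares-from-absorption-even j d _ _ ([k+1]*[k+d]C[k+1]≡d*[k+d]Ck j d)
... | inj₂ (nCj≡0 , nC[j+1]≡0) rewrite nCj≡0 | nC[j+1]≡0 = vanish (suc (2 * n) ∸ j) (suc j)
  where
  vanish : ∀ x s → x * 0 + s * 0 ≡ s * 0
  vanish = solve-∀

-- Closed forms

evenCount : ℕ → ℕ → ℕ
evenCount n k = (n C k) ^ 2 * (n !) ^ 2

oddCount : ℕ → ℕ → ℕ
oddCount n k = (k + 1) * (n C (k + 1)) ^ 2 * (n !) ^ 2 + (2 * n + 1 ∸ k) * (n C k) ^ 2 * (n !) ^ 2

oddCount≡ : ∀ n k → oddCount n k ≡ (suc k * (n C suc k) ^ 2 + (suc (2 * n) ∸ k) * (n C k) ^ 2) * (n !) ^ 2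
oddCount≡ n k rewrite +-comm k 1 | +-comm (2 * n) 1 =
  sym (*-distribʳ-+ ((n !) ^ 2) (suc k * (n C suc k) ^ 2) ((suc (2 * n) ∸ k) * (n C k) ^ 2))

x²*y*z²≡y*[x*z]² : ∀ x y z → x ^ 2 * y * z ^ 2 ≡ y * (x * z) ^ 2
x²*y*z²≡y*[x*z]² x y z rewrite x²≡x*x x | x²≡x*x z | x²≡x*x (x * z) = solve (x List.∷ y List.∷ z List.∷ List.[])

[k+1]*oddCount≡nCk²*[n+1]!² : ∀ n k → suc k * oddCount n k ≡ (n C k) ^ 2 * (suc n !) ^ 2
[k+1]*oddCount≡nCk²*[n+1]!² n k = begin
  suc k * oddCount n k
    ≡⟨ cong (suc k *_) (oddCount≡ n k) ⟩
  suc k * ((suc k * (n C suc k) ^ 2 + (suc (2 * n) ∸ k) * (n C k) ^ 2) * (n !) ^ 2)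
    ≡⟨ *-assoc (suc k) (suc k * (n C suc k) ^ 2 + (suc (2 * n) ∸ k) * (n C k) ^ 2) ((n !) ^ 2) ⟨
  suc k * (suc k * (n C suc k) ^ 2 + (suc (2 * n) ∸ k) * (n C k) ^ 2) * (n !) ^ 2
    ≡⟨ cong (_* (n !) ^ 2) ([k+1]*[[k+1]*nC[k+1]²+[2n+1-k]*nCk²]≡[n+1]²*nCk² n k) ⟩
  suc n ^ 2 * (n C k) ^ 2 * (n !) ^ 2
    ≡⟨ x²*y*z²≡y*[x*z]² (suc n) ((n C k) ^ 2) (n !) ⟩
  (n C k) ^ 2 * (suc n !) ^ 2 ∎
  where open ≡-Reasoning

oddCount-from-evenCount : ∀ n k →
  (suc (2 * n) ∸ k) * evenCount n k + suc k * evenCount n (suc k) ≡ oddCount n k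
oddCount-from-evenCount n k = trans (regroup (suc (2 * n) ∸ k) (suc k) ((n C k) ^ 2) ((n C suc k) ^ 2) ((n !) ^ 2))
                                    (sym (oddCount≡ n k))
  where
  regroup : ∀ x s a b F → x * (a * F) + s * (b * F) ≡ (s * b + x * a) * F
  regroup = solve-∀

evenCount-from-oddCount : ∀ n j →
  suc (suc j) * oddCount n (suc j) + (suc (2 * n) ∸ j) * oddCount n j ≡ evenCount (suc n) (suc j)
evenCount-from-oddCount n j = *-cancelˡ-≡ _ (evenCount (suc n) (suc j)) (suc j) (begin
  suc j * (suc (suc j) * oddCount n (suc j) + X * oddCount n j)
    ≡⟨ *-distribˡ-+ (suc j) (suc (suc j) * oddCount n (suc j)) (X * oddCount n j) ⟩
  suc j * (suc (suc j) * oddCount n (suc j)) + suc j * (X * oddCount n j)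
    ≡⟨ cong₂ _+_ (cong (suc j *_) ([k+1]*oddCount≡nCk²*[n+1]!² n (suc j))) (x*[y*z]≡y*[x*z] (suc j) X (oddCount n j)) ⟩
  suc j * ((n C suc j) ^ 2 * N²) + X * (suc j * oddCount n j)
    ≡⟨ cong (λ c → suc j * ((n C suc j) ^ 2 * N²) + X * c) ([k+1]*oddCount≡nCk²*[n+1]!² n j) ⟩
  suc j * ((n C suc j) ^ 2 * N²) + X * ((n C j) ^ 2 * N²)
    ≡⟨ regroup (suc j) X ((n C j) ^ 2) ((n C suc j) ^ 2) N² ⟩
  (X * (n C j) ^ 2 + suc j * (n C suc j) ^ 2) * N²
    ≡⟨ cong (_* N²) ([2n+1-j]*nCj²+[j+1]*nC[j+1]²≡[j+1]*[n+1]C[j+1]² n j) ⟩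
  suc j * (suc n C suc j) ^ 2 * N²
    ≡⟨ *-assoc (suc j) ((suc n C suc j) ^ 2) N² ⟩
  suc j * evenCount (suc n) (suc j) ∎)
  where
  open ≡-Reasoning
  X N² : ℕ
  X = suc (2 * n) ∸ j
  N² = (suc n !) ^ 2
  regroup : ∀ s x a b N → s * (b * N) + x * (a * N) ≡ (x * a + s * b) * N
  regroup = solve-∀

2∤1+2n : ∀ n → ¬ 2 ∣ suc (2 * n)
2∤1+2n n (divides q 1+2n≡q*2) = even≢odd q n (trans (*-comm 2 q) (sym 1+2n≡q*2))

2*[1+n]≡2+2n : ∀ n → 2 * suc n ≡ suc (suc (2 * n))
2*[1+n]≡2+2n n = *-suc 2 n

2∣2+2n : ∀ n → 2 ∣ suc (suc (2 * n))
2∣2+2n n = divides (suc n) (trans (sym (2*[1+n]≡2+2n n)) (*-comm 2 (suc n)))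

count-Sym′-2n : ∀ n k → count k (Sym′ (2 * n)) ≡ evenCount n k
count-Sym′-2n+1 : ∀ n k → count k (Sym′ (suc (2 * n))) ≡ oddCount n k
count-Sym′-2n+2 : ∀ n k → count k (Sym′ (suc (suc (2 * n)))) ≡ evenCount (suc n) k

count-Sym′-2n zero    zero    = refl
count-Sym′-2n zero    (suc k) = refl
count-Sym′-2n (suc n) k = trans (cong (count k ∘ Sym′) (2*[1+n]≡2+2n n)) (count-Sym′-2n+2 n k)

count-Sym′-2n+1 n k = begin
  count k (Sym′ (suc (2 * n)))
    ≡⟨ count-Sym′-odd (2 * n) (2∤1+2n n) k ⟩
  (suc (2 * n) ∸ k) * count k (Sym′ (2 * n)) + suc k * count (suc k) (Sym′ (2 * n))
    ≡⟨ cong₂ (λ u v → (suc (2 * n) ∸ k) * u + suc k * v) (count-Sym′-2n n k) (count-Sym′-2n n (suc k)) ⟩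
  (suc (2 * n) ∸ k) * evenCount n k + suc k * evenCount n (suc k)
    ≡⟨ oddCount-from-evenCount n k ⟩
  oddCount n k ∎
  where open ≡-Reasoning

count-Sym′-2n+2 n zero = begin
  count 0 (Sym′ (suc (suc (2 * n)))) ≡⟨ count-Sym′-even-zero (suc (2 * n)) (2∣2+2n n) ⟩
  count 0 (Sym′ (suc (2 * n)))       ≡⟨ count-Sym′-2n+1 n 0 ⟩
  oddCount n 0                       ≡⟨ *-identityˡ (oddCount n 0) ⟨
  1 * oddCount n 0                   ≡⟨ [k+1]*oddCount≡nCk²*[n+1]!² n 0 ⟩
  evenCount (suc n) 0                ∎
  where open ≡-Reasoning
count-Sym′-2n+2 n (suc j) = begin
  count (suc j) (Sym′ (suc (suc (2 * n))))
    ≡⟨ count-Sym′-even-suc (suc (2 * n)) (2∣2+2n n) j ⟩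
  suc (suc j) * count (suc j) (Sym′ (suc (2 * n))) + (suc (2 * n) ∸ j) * count j (Sym′ (suc (2 * n)))
    ≡⟨ cong₂ (λ u v → suc (suc j) * u + (suc (2 * n) ∸ j) * v) (count-Sym′-2n+1 n (suc j)) (count-Sym′-2n+1 n j) ⟩
  suc (suc j) * oddCount n (suc j) + (suc (2 * n) ∸ j) * oddCount n j
    ≡⟨ evenCount-from-oddCount n j ⟩
  evenCount (suc n) (suc j) ∎
  where open ≡-Reasoning

corollary3p5 : ∀ (n k : ℕ) → 1 ≤ n → k ≤ n →
    R k (2 * n + 1) ≡ (k + 1) * (n C (k + 1)) ^ 2 * (n !) ^ 2 + (2 * n + 1 ∸ k) * (n C k) ^ 2 * (n !) ^ 2
      × (k + 1) * ((k + 1) * (n C (k + 1)) ^ 2 * (n !) ^ 2 + (2 * n + 1 ∸ k) * (n C k) ^ 2 * (n !) ^ 2) ≡ (n C k) ^ 2 * ((n + 1) !) ^ 2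
corollary3p5 n k _ _ =
  trans (cong (R k) (+-comm (2 * n) 1)) (trans (R≡count-Sym′ k (suc (2 * n))) (count-Sym′-2n+1 n k)) ,
  subst₂ (λ k+1 n+1 → k+1 * oddCount n k ≡ (n C k) ^ 2 * (n+1 !) ^ 2) (+-comm 1 k) (+-comm 1 n)
         ([k+1]*oddCount≡nCk²*[n+1]!² n k)
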